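{- For integers $k\ge 1$, $d\ge 3$ and $a,b\ge 0$, $|V(L^{(k)}(S(d;a,b)))|<(d+a+b)^k\,2^{k^2/2}$.
   Context: Graphs are simple and undirected. For a graph $G=(V,E)$ the line graph $L(G)$ has vertex set $E$, with distinct $e,f\in E$ adjacent iff $e\cap f\neq\emptyset$; $L^{(0)}(G)=G$ and $L^{(j+1)}(G)=L(L^{(j)}(G))$. $S(d;a,b)$ denotes the tree obtained from a star with central vertex $c$ and $d$ leaves by attaching two further disjoint paths, one of length $a$ and one of length $b$, each having an endvertex identified with $c$ (so $S(d;a,b)$ has $d+a+b$ edges; a path of length $0$ adds nothing). -}

module Defs where

open import Data.Nat using (ℕ; zero; suc; _+_; _≡ᵇ_; _<ᵇ_; _≤ᵇ_)
open import Data.Bool using (Bool; true; false; _∧_; _∨_; not; if_then_else_)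
open import Data.Fin using (Fin; toℕ)
open import Data.List using (List; []; _∷_; [_]; concatMap; length; lookup; allFin)
open import Data.Product using (_×_; _,_)

-- The edge set is
--   { {i , j} : toℕ i < toℕ j and adj i j ≡ true },
-- i.e. only the "upper triangle" of adj is consulted.  Hence every value of
-- this record denotes a simple undirected graph (no loops, no multi-edges),
-- and every simple graph on Fin n arises this way.
record Graph : Set where
  field
    n   : ℕ
    adj : Fin n → Fin n → Bool

open Graph public

edgeList : (G : Graph) → List (Fin (n G) × Fin (n G))
edgeList G =
  concatMap (λ i → concatMap (λ j →
      if (toℕ i <ᵇ toℕ j) ∧ adj G i j then [ (i , j) ] else [])
    (allFin (n G))) (allFin (n G))

share : ∀ {m} → Fin m × Fin m → Fin m × Fin m → Bool
share (i , j) (k , l) =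
  (toℕ i ≡ᵇ toℕ k) ∨ (toℕ i ≡ᵇ toℕ l) ∨ (toℕ j ≡ᵇ toℕ k) ∨ (toℕ j ≡ᵇ toℕ l)

L : Graph → Graph
L G = record
  { n   = length (edgeList G)
  ; adj = λ x y → not (toℕ x ≡ᵇ toℕ y) ∧
                  share (lookup (edgeList G) x) (lookup (edgeList G) y) }

Lⁱ : ℕ → Graph → Graph
Lⁱ zero    G = G
Lⁱ (suc k) G = L (Lⁱ k G)

-- S(d;a,b) on vertex set {0,…,d+a+b}:
--   centre c = 0; leaves 1,…,d;
--   path of length a: 0 – d+1 – d+2 – … – d+a;
--   path of length b: 0 – d+a+1 – … – d+a+b.
-- sAdj i j decides adjacency for i < j (given as naturals).
sAdj : ℕ → ℕ → ℕ → ℕ → ℕ → Bool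
sAdj d a b zero j =
  (1 ≤ᵇ j) ∧ (j ≤ᵇ d + a + b) ∧
  ((j ≤ᵇ d) ∨ (j ≡ᵇ suc d) ∨ (j ≡ᵇ suc (d + a)))
sAdj d a b (suc i') j =
  (j ≡ᵇ suc (suc i')) ∧
  (((suc d ≤ᵇ suc i') ∧ (j ≤ᵇ d + a)) ∨
   ((suc (d + a) ≤ᵇ suc i') ∧ (j ≤ᵇ d + a + b)))

S : ℕ → ℕ → ℕ → Graph
S d a b = record
  { n   = suc (d + a + b)
  ; adj = λ i j → sAdj d a b (toℕ i) (toℕ j) }

module Submission where

-- Let M = d + a + b be the number of edges of S = S(d;a,b) and write
-- N_k = |V(L^(k) S)|.  The proof bounds N_k through maximum degrees.
--
-- The vertices of L G are the edges of G, so
--    |V(L G)| = |E(G)| ≤ |V(G)|·Δ(G); and an edge {i , j} of G meets at most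
--    deg i + deg j other edges, so Δ(L G) ≤ 2·Δ(G).  Degrees are split into
--    an "up" and a "down" part (neighbours above / below the vertex), which
--    matches the way Defs lists each edge once, as a pair (p , q) with p < q.
-- 2. The tree S.  Every vertex except the centre has exactly one neighbour
--    below it (its parent), so |E(S)| ≤ M; the centre has degree M and all
--    other vertices have degree at most 2, so Δ(S) ≤ M once M ≥ 2.
-- 3. Iteration.  Hence Δ(L^(j) S) ≤ 2^j·M, and N_1 ≤ M, N_(j+1) ≤ N_j·2^j·M
--    give N_k ≤ M^k·2^(0+1+…+(k-1)).  Squaring, N_k² ≤ M^(2k)·2^(k²-k), and
--    since 2 ≤ 2^k this is strictly below M^(2k)·2^(k²), which is the
--    theorem (stated in squared form to avoid the square root 2^(k²/2)).

open import Defs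
open import Data.Nat
  using (ℕ; zero; suc; _+_; _*_; _∸_; _^_; _≤_; _<_; z≤n; s≤s; _≡ᵇ_; _<ᵇ_; _≤ᵇ_)
open import Data.Nat.Properties
  using ( ≤-refl; ≤-trans; ≤-reflexive; <-asym; <⇒≱; <⇒≢; m≤m+n; m≤n⇒m≤1+n
        ; +-mono-≤; *-mono-≤; *-monoˡ-≤; +-identityʳ; +-assoc; *-identityʳ; *-assoc
        ; ^-distribˡ-+-*; ^-monoʳ-≤; m^n>0; m<m*n
        ; ≡ᵇ⇒≡; ≡⇒≡ᵇ; <ᵇ⇒<; ≤ᵇ⇒≤; ≤⇒≤ᵇ; +-0-commutativeMonoid; module ≤-Reasoning)
open import Data.Nat.Solver using (module +-*-Solver)
open import Data.Bool using (Bool; true; false; _∧_; _∨_; if_then_else_; T)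
open import Data.Bool.Properties using (T-∧; T-∨)
open import Data.Fin using (Fin; toℕ; zero; suc)
open import Data.List using (List; []; _∷_; [_]; _++_; concatMap; length; lookup; tabulate)
open import Data.Product using (_×_; _,_; proj₁; proj₂)
open import Data.Sum using (_⊎_; inj₁; inj₂)
open import Data.Empty using (⊥-elim)
open import Data.Unit using (tt)
open import Function using (_∘_)
open import Function.Bundles using (Equivalence)
open import Relation.Nullary using (¬_)
open import Relation.Binary.PropositionalEquality
  using (_≡_; _≢_; refl; sym; trans; cong; cong₂; subst; module ≡-Reasoning)
open import Algebra.Properties.CommutativeMonoid.Sum +-0-commutativeMonoid
  using (sum; ∑-distrib-+; ∑-comm; sum-cong-≗; sum-replicate-zero)

open +-*-Solver using (solve; _:+_; _:*_; _:=_; con)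
open Equivalence using (to; from)

∧-fst : ∀ x {y} → T (x ∧ y) → T x
∧-fst x = proj₁ ∘ to (T-∧ {x})

∧-snd : ∀ x {y} → T (x ∧ y) → T y
∧-snd x = proj₂ ∘ to (T-∧ {x})

∨-cases : ∀ x {y} → T (x ∨ y) → T x ⊎ T y
∨-cases x = to (T-∨ {x})

⟦_⟧ : Bool → ℕ
⟦ b ⟧ = if b then 1 else 0

⟦⟧≤1 : ∀ b → ⟦ b ⟧ ≤ 1
⟦⟧≤1 true  = ≤-refl
⟦⟧≤1 false = z≤n

⟦⟧-mono : ∀ {b c} → (T b → T c) → ⟦ b ⟧ ≤ ⟦ c ⟧
⟦⟧-mono {false}         _   = z≤n
⟦⟧-mono {true} {true}  _   = ≤-refl
⟦⟧-mono {true} {false} b⇒c = ⊥-elim (b⇒c tt)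

∑-mono : ∀ {n} {f g : Fin n → ℕ} → (∀ i → f i ≤ g i) → sum f ≤ sum g
∑-mono {zero}  _   = z≤n
∑-mono {suc n} f≤g = +-mono-≤ (f≤g zero) (∑-mono (f≤g ∘ suc))

∑-bounded : ∀ {n} {f : Fin n → ℕ} c → (∀ i → f i ≤ c) → sum f ≤ n * c
∑-bounded {zero}  c _   = z≤n
∑-bounded {suc n} c f≤c = +-mono-≤ (f≤c zero) (∑-bounded c (f≤c ∘ suc))

∑-if : ∀ {n} b (f : Fin n → ℕ) →
  sum (λ i → if b then f i else 0) ≡ (if b then sum f else 0)
∑-if     true  f = refl
∑-if {n} false f = sum-replicate-zero n

∑-select : ∀ {n} (v : Fin n) (g : Fin n → ℕ) →
  sum (λ p → if toℕ v ≡ᵇ toℕ p then g p else 0) ≡ g v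
∑-select {suc n} zero    g = trans (cong (g zero +_) (sum-replicate-zero n)) (+-identityʳ _)
∑-select         (suc v) g = ∑-select v (g ∘ suc)

∑-≡ᵇ≤1 : ∀ n c → sum {n} (λ p → ⟦ toℕ p ≡ᵇ c ⟧) ≤ 1
∑-≡ᵇ≤1 zero    c       = z≤n
∑-≡ᵇ≤1 (suc n) zero    = ≤-reflexive (cong suc (sum-replicate-zero n))
∑-≡ᵇ≤1 (suc n) (suc c) = ∑-≡ᵇ≤1 n c

∑-list : {A : Set} → (A → ℕ) → List A → ℕ
∑-list g []       = 0
∑-list g (x ∷ xs) = g x + ∑-list g xs

length≡∑-list : {A : Set} (xs : List A) → length xs ≡ ∑-list (λ _ → 1) xs
length≡∑-list []       = refl
length≡∑-list (x ∷ xs) = cong suc (length≡∑-list xs)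

∑-list-++ : {A : Set} (g : A → ℕ) (xs ys : List A) →
  ∑-list g (xs ++ ys) ≡ ∑-list g xs + ∑-list g ys
∑-list-++ g []       ys = refl
∑-list-++ g (x ∷ xs) ys = trans (cong (g x +_) (∑-list-++ g xs ys)) (sym (+-assoc (g x) _ _))

∑-list-singleton : {A : Set} (g : A → ℕ) (b : Bool) (x : A) →
  ∑-list g (if b then [ x ] else []) ≡ (if b then g x else 0)
∑-list-singleton g true  x = +-identityʳ (g x)
∑-list-singleton g false x = refl

∑-list-concatMap : {A B : Set} {n : ℕ} (f : Fin n → A) (h : A → List B) (g : B → ℕ) →
  ∑-list g (concatMap h (tabulate f)) ≡ sum (λ i → ∑-list g (h (f i)))
∑-list-concatMap {n = zero}  f h g = refl
∑-list-concatMap {n = suc n} f h g =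
  trans (∑-list-++ g (h (f zero)) _) (cong (∑-list g (h (f zero)) +_) (∑-list-concatMap (f ∘ suc) h g))

∑-lookup : {A : Set} (xs : List A) (g : A → ℕ) → sum (λ y → g (lookup xs y)) ≡ ∑-list g xs
∑-lookup []       g = refl
∑-lookup (x ∷ xs) g = cong (g x +_) (∑-lookup xs g)

isEdge : (G : Graph) → Fin (n G) → Fin (n G) → Bool
isEdge G p q = (toℕ p <ᵇ toℕ q) ∧ adj G p q

upDeg : (G : Graph) → Fin (n G) → ℕ
upDeg G v = sum (λ q → ⟦ isEdge G v q ⟧)

downDeg : (G : Graph) → Fin (n G) → ℕ
downDeg G v = sum (λ p → ⟦ isEdge G p v ⟧)

deg : (G : Graph) → Fin (n G) → ℕ
deg G v = upDeg G v + downDeg G v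

∑-edgeList : (G : Graph) (g : Fin (n G) × Fin (n G) → ℕ) →
  ∑-list g (edgeList G) ≡ sum (λ p → sum (λ q → if isEdge G p q then g (p , q) else 0))
∑-edgeList G g =
  trans (∑-list-concatMap (λ p → p) row g) (sum-cong-≗ λ p →
  trans (∑-list-concatMap (λ q → q) (entry p) g) (sum-cong-≗ λ q →
  ∑-list-singleton g (isEdge G p q) (p , q)))
  where
  entry : Fin (n G) → Fin (n G) → List (Fin (n G) × Fin (n G))
  entry p q = if isEdge G p q then [ (p , q) ] else []
  row : Fin (n G) → List (Fin (n G) × Fin (n G))
  row p = concatMap (entry p) (tabulate (λ q → q))

order-L : (G : Graph) → n (L G) ≡ sum (upDeg G)
order-L G = trans (length≡∑-list (edgeList G)) (∑-edgeList G (λ _ → 1))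

∑-upDeg≡∑-downDeg : (G : Graph) → sum (upDeg G) ≡ sum (downDeg G)
∑-upDeg≡∑-downDeg G = ∑-comm (λ p q → ⟦ isEdge G p q ⟧)

order-L-bound : (G : Graph) (D : ℕ) → (∀ v → deg G v ≤ D) → n (L G) ≤ n G * D
order-L-bound G D deg≤D =
  subst (_≤ n G * D) (sym (order-L G)) (∑-bounded D λ v → ≤-trans (m≤m+n _ _) (deg≤D v))

incident : ∀ {m} → Fin m → Fin m × Fin m → Bool
incident v (p , q) = (toℕ v ≡ᵇ toℕ p) ∨ (toℕ v ≡ᵇ toℕ q)

incidences : (G : Graph) → Fin (n G) → ℕ
incidences G v = ∑-list (λ e → ⟦ incident v e ⟧) (edgeList G)

incident-split : ∀ {m} (v p q : Fin m) b →
  (if b then ⟦ incident v (p , q) ⟧ else 0)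
    ≤ (if toℕ v ≡ᵇ toℕ p then ⟦ b ⟧ else 0) + (if toℕ v ≡ᵇ toℕ q then ⟦ b ⟧ else 0)
incident-split v p q false = z≤n
incident-split v p q true with toℕ v ≡ᵇ toℕ p | toℕ v ≡ᵇ toℕ q
... | true  | _     = s≤s z≤n
... | false | true  = s≤s z≤n
... | false | false = z≤n

incidences≤deg : (G : Graph) (v : Fin (n G)) → incidences G v ≤ deg G v
incidences≤deg G v = begin
  incidences G v
    ≡⟨ ∑-edgeList G _ ⟩
  sum (λ p → sum (λ q → if isEdge G p q then ⟦ incident v (p , q) ⟧ else 0))
    ≤⟨ ∑-mono (λ p → ∑-mono λ q → incident-split v p q (isEdge G p q)) ⟩
  sum (λ p → sum (λ q → first p q + second p q))
    ≡⟨ sum-cong-≗ (λ p → ∑-distrib-+ (first p) (second p)) ⟩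
  sum (λ p → sum (first p) + sum (second p))
    ≡⟨ ∑-distrib-+ (λ p → sum (first p)) (λ p → sum (second p)) ⟩
  sum (λ p → sum (first p)) + sum (λ p → sum (second p))
    ≡⟨ cong₂ _+_ (trans (sum-cong-≗ λ p → ∑-if (toℕ v ≡ᵇ toℕ p) (λ q → ⟦ isEdge G p q ⟧))
                        (∑-select v (upDeg G)))
                 (sum-cong-≗ λ p → ∑-select v (λ q → ⟦ isEdge G p q ⟧)) ⟩
  deg G v ∎
  where
  open ≤-Reasoning
  first second : Fin (n G) → Fin (n G) → ℕ
  first  p q = if toℕ v ≡ᵇ toℕ p then ⟦ isEdge G p q ⟧ else 0
  second p q = if toℕ v ≡ᵇ toℕ q then ⟦ isEdge G p q ⟧ else 0

≡ᵇ-sym : ∀ x y → (x ≡ᵇ y) ≡ (y ≡ᵇ x)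
≡ᵇ-sym zero    zero    = refl
≡ᵇ-sym zero    (suc y) = refl
≡ᵇ-sym (suc x) zero    = refl
≡ᵇ-sym (suc x) (suc y) = ≡ᵇ-sym x y

share-sym : ∀ {m} (e f : Fin m × Fin m) → share e f ≡ share f e
share-sym (i , j) (k , l)
  rewrite ≡ᵇ-sym (toℕ k) (toℕ i) | ≡ᵇ-sym (toℕ k) (toℕ j)
        | ≡ᵇ-sym (toℕ l) (toℕ i) | ≡ᵇ-sym (toℕ l) (toℕ j)
  = swap-middle (toℕ i ≡ᵇ toℕ k) (toℕ i ≡ᵇ toℕ l) (toℕ j ≡ᵇ toℕ k) (toℕ j ≡ᵇ toℕ l)
  where
  swap-middle : ∀ w x y z → w ∨ x ∨ y ∨ z ≡ w ∨ y ∨ x ∨ z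
  swap-middle true  x     y     z = refl
  swap-middle false true  true  z = refl
  swap-middle false true  false z = refl
  swap-middle false false y     z = refl

share-split : ∀ {m} (e f : Fin m × Fin m) →
  ⟦ share e f ⟧ ≤ ⟦ incident (proj₁ e) f ⟧ + ⟦ incident (proj₂ e) f ⟧
share-split (i , j) (k , l) =
  ∨-split (toℕ i ≡ᵇ toℕ k) (toℕ i ≡ᵇ toℕ l) ((toℕ j ≡ᵇ toℕ k) ∨ (toℕ j ≡ᵇ toℕ l))
  where
  ∨-split : ∀ x y z → ⟦ x ∨ y ∨ z ⟧ ≤ ⟦ x ∨ y ⟧ + ⟦ z ⟧
  ∨-split true  y     z = s≤s z≤n
  ∨-split false true  z = s≤s z≤n
  ∨-split false false z = ≤-refl

-- Of the two orientations of a pair of positions, at most one is recorded,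
-- so a symmetric relation s is counted at most once.
one-orientation : ∀ x y (X Y s t : Bool) → t ≡ s →
  ⟦ (x <ᵇ y) ∧ X ∧ s ⟧ + ⟦ (y <ᵇ x) ∧ Y ∧ t ⟧ ≤ ⟦ s ⟧
one-orientation x y X Y s t t≡s with x <ᵇ y in x<y | y <ᵇ x in y<x
... | true  | true  = ⊥-elim (<-asym (<ᵇ⇒< x y (subst T (sym x<y) tt)) (<ᵇ⇒< y x (subst T (sym y<x) tt)))
... | true  | false = ≤-trans (≤-reflexive (+-identityʳ _)) (⟦⟧-mono (∧-snd X))
... | false | true  = subst (λ t → ⟦ Y ∧ t ⟧ ≤ ⟦ s ⟧) (sym t≡s) (⟦⟧-mono (∧-snd Y))
... | false | false = z≤n

deg-L : (G : Graph) (x : Fin (n (L G))) →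
  deg (L G) x ≤ deg G (proj₁ (lookup (edgeList G) x)) + deg G (proj₂ (lookup (edgeList G) x))
deg-L G x = begin
  deg (L G) x
    ≡⟨ sym (∑-distrib-+ (λ y → ⟦ isEdge (L G) x y ⟧) (λ y → ⟦ isEdge (L G) y x ⟧)) ⟩
  sum (λ y → ⟦ isEdge (L G) x y ⟧ + ⟦ isEdge (L G) y x ⟧)
    ≤⟨ ∑-mono (λ y → one-orientation (toℕ x) (toℕ y) _ _ _ _ (share-sym (e y) (e x))) ⟩
  sum (λ y → ⟦ share (e x) (e y) ⟧)
    ≤⟨ ∑-mono (λ y → share-split (e x) (e y)) ⟩
  sum (λ y → ⟦ incident i (e y) ⟧ + ⟦ incident j (e y) ⟧)
    ≡⟨ ∑-distrib-+ (λ y → ⟦ incident i (e y) ⟧) (λ y → ⟦ incident j (e y) ⟧) ⟩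
  sum (λ y → ⟦ incident i (e y) ⟧) + sum (λ y → ⟦ incident j (e y) ⟧)
    ≡⟨ cong₂ _+_ (∑-lookup (edgeList G) _) (∑-lookup (edgeList G) _) ⟩
  incidences G i + incidences G j
    ≤⟨ +-mono-≤ (incidences≤deg G i) (incidences≤deg G j) ⟩
  deg G i + deg G j ∎
  where
  open ≤-Reasoning
  e : Fin (n (L G)) → Fin (n G) × Fin (n G)
  e = lookup (edgeList G)
  i j : Fin (n G)
  i = proj₁ (e x)
  j = proj₂ (e x)

deg-L-bound : (G : Graph) (D : ℕ) → (∀ v → deg G v ≤ D) → ∀ x → deg (L G) x ≤ 2 * D
deg-L-bound G D deg≤D x =
  ≤-trans (deg-L G x) (≤-trans (+-mono-≤ (deg≤D _) (deg≤D _)) (≤-reflexive (cong (D +_) (sym (+-identityʳ D)))))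

module Tree (d a b : ℕ) where

  M : ℕ
  M = d + a + b

  SG : Graph
  SG = S d a b

  -- The parent of a vertex j ≥ 1: the centre 0 for the leaves 1, …, d and
  -- for the first vertices d+1 and d+a+1 of the two paths, and j - 1 for
  -- every other path vertex.
  parent : ℕ → ℕ
  parent j = if (j ≤ᵇ suc d) ∨ (j ≡ᵇ suc (d + a)) then 0 else j ∸ 1

  child-of-centre : ∀ j → T ((j ≤ᵇ d) ∨ (j ≡ᵇ suc d) ∨ (j ≡ᵇ suc (d + a))) → parent j ≡ 0
  child-of-centre j t = if-true (first-vertex (∨-cases (j ≤ᵇ d) t))
    where
    first-vertex : T (j ≤ᵇ d) ⊎ T ((j ≡ᵇ suc d) ∨ (j ≡ᵇ suc (d + a))) →
                   T ((j ≤ᵇ suc d) ∨ (j ≡ᵇ suc (d + a)))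
    first-vertex (inj₁ j≤d) = from (T-∨ {j ≤ᵇ suc d}) (inj₁ (≤⇒≤ᵇ (m≤n⇒m≤1+n (≤ᵇ⇒≤ j d j≤d))))
    first-vertex (inj₂ t′) with ∨-cases (j ≡ᵇ suc d) t′
    ... | inj₁ j≡1+d = from (T-∨ {j ≤ᵇ suc d}) (inj₁ (≤⇒≤ᵇ (≤-reflexive (≡ᵇ⇒≡ j (suc d) j≡1+d))))
    ... | inj₂ j≡1+d+a = from (T-∨ {j ≤ᵇ suc d}) (inj₂ j≡1+d+a)
    if-true : ∀ {c} → T c → (if c then 0 else j ∸ 1) ≡ 0
    if-true {true} _ = refl

  inner-path-vertex : ∀ j → suc d < j → j ≢ suc (d + a) → parent j ≡ j ∸ 1
  inner-path-vertex j d+1<j j≢ = if-false (not-first-vertex ∘ ∨-cases (j ≤ᵇ suc d))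
    where
    not-first-vertex : ¬ (T (j ≤ᵇ suc d) ⊎ T (j ≡ᵇ suc (d + a)))
    not-first-vertex (inj₁ j≤1+d)   = <⇒≱ d+1<j (≤ᵇ⇒≤ j (suc d) j≤1+d)
    not-first-vertex (inj₂ j≡1+d+a) = j≢ (≡ᵇ⇒≡ j (suc (d + a)) j≡1+d+a)
    if-false : ∀ {c} → ¬ T c → (if c then 0 else j ∸ 1) ≡ j ∸ 1
    if-false {true}  ¬c = ⊥-elim (¬c tt)
    if-false {false} _  = refl

  along-path : ∀ i →
    T (((suc d ≤ᵇ suc i) ∧ (suc (suc i) ≤ᵇ d + a)) ∨
       ((suc (d + a) ≤ᵇ suc i) ∧ (suc (suc i) ≤ᵇ d + a + b))) →
    suc d < suc (suc i) × suc (suc i) ≢ suc (d + a)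
  along-path i t with ∨-cases ((suc d ≤ᵇ suc i) ∧ (suc (suc i) ≤ᵇ d + a)) t
  ... | inj₁ on-a-path =
    s≤s (≤ᵇ⇒≤ (suc d) (suc i) (∧-fst (suc d ≤ᵇ suc i) on-a-path)) ,
    <⇒≢ (s≤s (≤ᵇ⇒≤ (suc (suc i)) (d + a) (∧-snd (suc d ≤ᵇ suc i) on-a-path)))
  ... | inj₂ on-b-path =
    s≤s (≤-trans (s≤s (m≤m+n d a)) d+a<i+1) ,
    <⇒≢ (s≤s d+a<i+1) ∘ sym
    where
    d+a<i+1 : suc (d + a) ≤ suc i
    d+a<i+1 = ≤ᵇ⇒≤ (suc (d + a)) (suc i) (∧-fst (suc (d + a) ≤ᵇ suc i) on-b-path)

  lower-neighbour-is-parent : ∀ p j → T ((p <ᵇ j) ∧ sAdj d a b p j) → p ≡ parent j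
  lower-neighbour-is-parent zero j t =
    sym (child-of-centre j (∧-snd (j ≤ᵇ d + a + b) (∧-snd (1 ≤ᵇ j) (∧-snd (0 <ᵇ j) t))))
  lower-neighbour-is-parent (suc i) j t
    with ≡ᵇ⇒≡ j (suc (suc i)) (∧-fst (j ≡ᵇ suc (suc i)) (∧-snd (suc i <ᵇ j) t))
  ... | refl =
    let (d+1<j , j≢) = along-path i (∧-snd (suc (suc i) ≡ᵇ suc (suc i)) (∧-snd (suc i <ᵇ suc (suc i)) t))
    in sym (inner-path-vertex (suc (suc i)) d+1<j j≢)

  downDeg≤1 : ∀ v → downDeg SG v ≤ 1
  downDeg≤1 v = ≤-trans
    (∑-mono {n = suc M} {g = λ p → ⟦ toℕ p ≡ᵇ parent (toℕ v) ⟧} λ p → ⟦⟧-mono λ t → ≡⇒≡ᵇ (toℕ p) _ (lower-neighbour-is-parent (toℕ p) (toℕ v) t))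
    (∑-≡ᵇ≤1 (suc M) (parent (toℕ v)))

  downDeg-centre : downDeg SG zero ≡ 0
  downDeg-centre = sum-replicate-zero (suc M)

  upDeg≤1 : ∀ v → upDeg SG (suc v) ≤ 1
  upDeg≤1 v = ≤-trans
    (∑-mono {n = suc M} {f = λ q → ⟦ isEdge SG (suc v) q ⟧} {g = λ q → ⟦ toℕ q ≡ᵇ suc (suc (toℕ v)) ⟧} λ q →
      ⟦⟧-mono λ t → ∧-fst (toℕ q ≡ᵇ suc (suc (toℕ v))) (∧-snd (suc (toℕ v) <ᵇ toℕ q) t))
    (∑-≡ᵇ≤1 (suc M) (suc (suc (toℕ v))))

  -- |E(S)| ≤ M: count every edge at its upper endpoint, which is not the centre.
  order-L-S : n (L SG) ≤ M
  order-L-S = begin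
    n (L SG)                     ≡⟨ trans (order-L SG) (∑-upDeg≡∑-downDeg SG) ⟩
    sum (downDeg SG)             ≡⟨ cong (_+ sum (downDeg SG ∘ suc)) downDeg-centre ⟩
    sum (downDeg SG ∘ suc)       ≤⟨ ∑-bounded 1 (downDeg≤1 ∘ suc) ⟩
    M * 1                        ≡⟨ *-identityʳ M ⟩
    M                            ∎
    where open ≤-Reasoning

  -- Δ(S) ≤ M: the centre has M neighbours, every other vertex at most 2.
  deg-S : 2 ≤ M → ∀ v → deg SG v ≤ M
  deg-S 2≤M zero = begin
    upDeg SG zero + downDeg SG zero ≡⟨ trans (cong (upDeg SG zero +_) downDeg-centre) (+-identityʳ _) ⟩
    upDeg SG zero                   ≤⟨ ∑-bounded 1 (λ q → ⟦⟧≤1 (isEdge SG zero (suc q))) ⟩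
    M * 1                           ≡⟨ *-identityʳ M ⟩
    M                               ∎
    where open ≤-Reasoning
  deg-S 2≤M (suc v) = ≤-trans (+-mono-≤ (upDeg≤1 v) (downDeg≤1 (suc v))) 2≤M

triangle : ℕ → ℕ
triangle zero    = 0
triangle (suc k) = triangle k + k

triangle-double : ∀ k → triangle k + triangle k + k ≡ k * k
triangle-double zero    = refl
triangle-double (suc k) = begin
  (t + k) + (t + k) + suc k ≡⟨ solve 2 (λ t k → (t :+ k) :+ (t :+ k) :+ (con 1 :+ k)
                                            := (t :+ t :+ k) :+ (con 1 :+ k :+ k)) refl t k ⟩
  (t + t + k) + (suc k + k) ≡⟨ cong (_+ (suc k + k)) (triangle-double k) ⟩
  k * k + (suc k + k)       ≡⟨ solve 1 (λ k → k :* k :+ (con 1 :+ k :+ k) := (con 1 :+ k) :* (con 1 :+ k)) refl k ⟩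
  suc k * suc k             ∎
  where
  open ≡-Reasoning
  t = triangle k

module Iterated (d a b : ℕ) (2≤M : 2 ≤ d + a + b) where
  open Tree d a b using (M; SG; order-L-S; deg-S)

  Lᵏ : ℕ → Graph
  Lᵏ k = Lⁱ k SG

  deg-Lᵏ : ∀ k v → deg (Lᵏ k) v ≤ 2 ^ k * M
  deg-Lᵏ zero    v = ≤-trans (deg-S 2≤M v) (≤-reflexive (sym (+-identityʳ M)))
  deg-Lᵏ (suc k) v =
    ≤-trans (deg-L-bound (Lᵏ k) (2 ^ k * M) (deg-Lᵏ k) v) (≤-reflexive (sym (*-assoc 2 (2 ^ k) M)))

  order-Lᵏ : ∀ k → n (Lᵏ (suc k)) ≤ M ^ suc k * 2 ^ triangle (suc k)
  order-Lᵏ zero = ≤-trans order-L-S (≤-reflexive (sym (trans (*-identityʳ (M * 1)) (*-identityʳ M))))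
  order-Lᵏ (suc k) = begin
    n (L (Lᵏ (suc k)))
      ≤⟨ order-L-bound (Lᵏ (suc k)) (2 ^ suc k * M) (deg-Lᵏ (suc k)) ⟩
    n (Lᵏ (suc k)) * (2 ^ suc k * M)
      ≤⟨ *-monoˡ-≤ (2 ^ suc k * M) (order-Lᵏ k) ⟩
    (M ^ suc k * 2 ^ t) * (2 ^ suc k * M)
      ≡⟨ solve 4 (λ m x p q → (x :* p) :* (q :* m) := (m :* x) :* (p :* q))
               refl M (M ^ suc k) (2 ^ t) (2 ^ suc k) ⟩
    M ^ suc (suc k) * (2 ^ t * 2 ^ suc k)
      ≡⟨ cong (M ^ suc (suc k) *_) (sym (^-distribˡ-+-* 2 t (suc k))) ⟩
    M ^ suc (suc k) * 2 ^ triangle (suc (suc k)) ∎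
    where
    open ≤-Reasoning
    t = triangle (suc k)

double-≤⇒< : ∀ x y → x * 2 ≤ y → 0 < y → x < y
double-≤⇒< zero    y _   0<y = 0<y
double-≤⇒< (suc x) y 2x≤y _   = ≤-trans (m<m*n (suc x) 2 (s≤s (s≤s z≤n))) 2x≤y

mainTheorem4 : (k d a b : ℕ) → 1 ≤ k → 3 ≤ d →
    n (Lⁱ k (S d a b)) * n (Lⁱ k (S d a b))
      < ((d + a + b) ^ k * (d + a + b) ^ k) * 2 ^ (k * k)
mainTheorem4 zero    d a b () _
mainTheorem4 (suc k) d a b _ (s≤s (s≤s (s≤s _))) =
  double-≤⇒< (N * N) bound N²·2≤bound 0<bound
  where
  open Iterated d a b (s≤s (s≤s z≤n))
  M = d + a + b
  j = suc k
  N = n (Lᵏ j)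
  X = M ^ j
  t = 2 ^ triangle j
  bound = (X * X) * 2 ^ (j * j)
  0<bound : 0 < bound
  0<bound = *-mono-≤ (*-mono-≤ (m^n>0 M j) (m^n>0 M j)) (m^n>0 2 (j * j))
  N²·2≤bound : N * N * 2 ≤ bound
  N²·2≤bound = begin
    N * N * 2             ≤⟨ *-mono-≤ (*-mono-≤ (order-Lᵏ k) (order-Lᵏ k)) (^-monoʳ-≤ 2 {1} {j} (s≤s z≤n)) ⟩
    (X * t) * (X * t) * 2 ^ j
      ≡⟨ solve 3 (λ x t p → (x :* t) :* (x :* t) :* p := (x :* x) :* (t :* t :* p)) refl X t (2 ^ j) ⟩
    (X * X) * (t * t * 2 ^ j)
      ≡⟨ cong ((X * X) *_) (sym (trans (^-distribˡ-+-* 2 (triangle j + triangle j) j)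
                                         (cong (_* 2 ^ j) (^-distribˡ-+-* 2 (triangle j) (triangle j))))) ⟩
    (X * X) * 2 ^ (triangle j + triangle j + j)
      ≡⟨ cong (λ e → (X * X) * 2 ^ e) (triangle-double j) ⟩
    bound ∎
    where open ≤-Reasoning
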